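{- If $A\models B$ then (1) if $A\{\alpha\mapsto s_1\},\ldots,A\{\alpha\mapsto s_k\},\Gamma\rightarrow$ is not valid, then $B$ is not a solution; (2) if $A$ is a solution then $\Gamma\rightarrow B$ is valid; (3) if $A$ is a solution, then $B\{\alpha\mapsto s_1\},\ldots,B\{\alpha\mapsto s_k\},\Gamma\rightarrow$ is valid iff $[X\mapsto\lambda\alpha.B]$ is a solution of $H$.
   Context: Fix a quantifier-free $F$ with free variable $x$ and a 1-grammar $U\circ V$, $U=\{u_1,\ldots,u_m\}$, $V=\{s_1,\ldots,s_k\}$, with schematic extended Herbrand sequent $H=F\{x\mapsto u_1\},\ldots,F\{x\mapsto u_m\},X(\alpha)\supset\bigwedge_{j=1}^kX(s_j)\rightarrow$ ($\{x\mapsto t\}$ denotes substitution), and let $\Gamma=F\{x\mapsto u_1\},\ldots,F\{x\mapsto u_m\}$. $\alpha$ is treated as a constant and $\models$ denotes propositional consequence. A quantifier-free formula $A$ is a solution (i.e. $[X\mapsto\lambda\alpha.A]$ is a solution of $H$) if $\Gamma,A\supset\bigwedge_{j=1}^kA\{\alpha\mapsto s_j\}\rightarrow$ is a tautology. -}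

module Defs where

open import Data.Nat using (ℕ; _≡ᵇ_)
open import Data.Bool using (Bool; true; false; if_then_else_; _∧_; _∨_; not; T)
open import Data.List using (List; []; _∷_; map; foldr; _++_)
open import Data.List.Relation.Unary.All using (All)
open import Data.List.Relation.Unary.Any using (Any)

-- First-order terms: variables (named by ℕ), the distinguished constant α
-- (the nonterminal of the grammar, treated as a constant), and function
-- symbols (named by ℕ) applied to argument lists.
data Term : Set where
  var : ℕ → Term
  αc  : Term
  fn  : ℕ → List Term → Term

data Formula : Set where
  atom : ℕ → List Term → Formula
  ⊥f   : Formula
  ⊤f   : Formula
  ¬f_  : Formula → Formula
  _∧f_ : Formula → Formula → Formula
  _∨f_ : Formula → Formula → Formula
  _⊃f_ : Formula → Formula → Formula

mutual
  substαᵗ : Term → Term → Term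
  substαᵗ s (var n)   = var n
  substαᵗ s αc        = s
  substαᵗ s (fn f ts) = fn f (substαˡ s ts)

  substαˡ : Term → List Term → List Term
  substαˡ s []       = []
  substαˡ s (t ∷ ts) = substαᵗ s t ∷ substαˡ s ts

mutual
  substᵗ : ℕ → Term → Term → Term
  substᵗ x u (var n)   = if n ≡ᵇ x then u else var n
  substᵗ x u αc        = αc
  substᵗ x u (fn f ts) = fn f (substˡ x u ts)

  substˡ : ℕ → Term → List Term → List Term
  substˡ x u []       = []
  substˡ x u (t ∷ ts) = substᵗ x u t ∷ substˡ x u ts

_[α↦_] : Formula → Term → Formula
atom P ts [α↦ s ] = atom P (substαˡ s ts)
⊥f        [α↦ s ] = ⊥f
⊤f        [α↦ s ] = ⊤f
(¬f A)    [α↦ s ] = ¬f (A [α↦ s ])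
(A ∧f B)  [α↦ s ] = (A [α↦ s ]) ∧f (B [α↦ s ])
(A ∨f B)  [α↦ s ] = (A [α↦ s ]) ∨f (B [α↦ s ])
(A ⊃f B)  [α↦ s ] = (A [α↦ s ]) ⊃f (B [α↦ s ])

_[_↦_] : Formula → ℕ → Term → Formula
atom P ts [ x ↦ u ] = atom P (substˡ x u ts)
⊥f        [ x ↦ u ] = ⊥f
⊤f        [ x ↦ u ] = ⊤f
(¬f A)    [ x ↦ u ] = ¬f (A [ x ↦ u ])
(A ∧f B)  [ x ↦ u ] = (A [ x ↦ u ]) ∧f (B [ x ↦ u ])
(A ∨f B)  [ x ↦ u ] = (A [ x ↦ u ]) ∨f (B [ x ↦ u ])
(A ⊃f B)  [ x ↦ u ] = (A [ x ↦ u ]) ⊃f (B [ x ↦ u ])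

-- Propositional semantics: atoms (syntactic objects, α a constant) are
-- propositional variables; a valuation assigns a truth value to each atom.
Valuation : Set
Valuation = ℕ → List Term → Bool

eval : Valuation → Formula → Bool
eval v (atom P ts) = v P ts
eval v ⊥f          = false
eval v ⊤f          = true
eval v (¬f A)      = not (eval v A)
eval v (A ∧f B)    = eval v A ∧ eval v B
eval v (A ∨f B)    = eval v A ∨ eval v B
eval v (A ⊃f B)    = not (eval v A) ∨ eval v B

_⊨_ : Formula → Formula → Set
A ⊨ B = (v : Valuation) → T (eval v A) → T (eval v B)

Valid : List Formula → List Formula → Set
Valid Δ Π = (v : Valuation) → All (λ A → T (eval v A)) Δ → Any (λ B → T (eval v B)) Π

⋀ : List Formula → Formula
⋀ = foldr _∧f_ ⊤f

Γ : Formula → ℕ → List Term → List Formula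
Γ F x U = map (λ u → F [ x ↦ u ]) U

instances : Formula → List Term → List Formula
instances A V = map (λ s → A [α↦ s ]) V

-- [X ↦ λα.A] is a solution of the schematic extended Herbrand sequent
-- H = Γ, X(α) ⊃ ⋀ⱼ X(sⱼ) →  : the sequent  Γ, A ⊃ ⋀ⱼ A{α↦sⱼ} →  is a tautology.
IsSolution : Formula → ℕ → List Term → List Term → Formula → Set
IsSolution F x U V A = Valid (Γ F x U ++ (A ⊃f ⋀ (instances A V)) ∷ []) []

module Submission where

-- Proof idea.  Everything is propositional, so we reason about a single
-- valuation v at a time.  Write  v ⊩ Δ  for "v satisfies every formula of Δ".
--
--  * Substituting s for α commutes with evaluation up to shifting the
--    valuation (eval-substα), hence A ⊨ B implies A{α↦s} ⊨ B{α↦s}, and every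
--    model of the instances of A is a model of the instances of B.
--  * Unfolding IsSolution: C is a solution iff no model of Γ satisfies the
--    implication C ⊃ ⋀ⱼ C{α↦sⱼ} (solution-refutes).  Two consequences:
--    - every model of Γ satisfies C, since otherwise the implication holds
--      vacuously (solution-holds-on-Γ);
--    - the instances of C together with Γ are inconsistent, since a model
--      of them satisfies the implication trivially (solution-instances-refuted).
--
-- Then (1) is the second consequence for B, transported to the instances of
-- A; (2) is the first consequence for A followed by A ⊨ B; and in (3) the
-- direction "solution ⇒ inconsistent" is again the second consequence,
-- while the converse uses (2): a model of Γ satisfies B, so if it satisfied
-- B ⊃ ⋀ⱼ B{α↦sⱼ} it would be a model of the instances of B and of Γ.

open import Defs
open import Data.Nat using (ℕ)
open import Data.List using (List; []; _∷_; _++_)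
open import Data.Product using (_×_; _,_)
open import Data.Bool using (Bool; true; false; T; not; _∨_)
open import Data.Bool.Properties using (T-∧)
open import Data.Unit using (tt)
open import Data.Empty using (⊥; ⊥-elim)
open import Data.List.Relation.Unary.All as All using (All; []; _∷_)
open import Data.List.Relation.Unary.All.Properties using (++⁺; ++⁻; map⁺; map⁻)
open import Data.List.Relation.Unary.Any using (here)
open import Relation.Nullary using (¬_; yes; no)
open import Relation.Nullary.Decidable using (T?)
open import Relation.Binary.PropositionalEquality using (_≡_; refl; subst; sym)
open import Function.Bundles using (_⇔_; mk⇔; Equivalence)

_⊩_ : Valuation → List Formula → Set
v ⊩ Δ = All (λ C → T (eval v C)) Δ

valid-by-refutation : {Δ : List Formula} →
  ((v : Valuation) → v ⊩ Δ → ⊥) → Valid Δ []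
valid-by-refutation refute v sat with () ← refute v sat

refuted-by-valid : {Δ : List Formula} → Valid Δ [] → (v : Valuation) → v ⊩ Δ → ⊥
refuted-by-valid valid v sat with () ← valid v sat

⋀-intro : (v : Valuation) (L : List Formula) → v ⊩ L → T (eval v (⋀ L))
⋀-intro v []      []       = tt
⋀-intro v (C ∷ L) (c ∷ cs) = Equivalence.from T-∧ (c , ⋀-intro v L cs)

⋀-elim : (v : Valuation) (L : List Formula) → T (eval v (⋀ L)) → v ⊩ L
⋀-elim v []      _ = []
⋀-elim v (C ∷ L) t with Equivalence.to T-∧ t
... | c , cs = c ∷ ⋀-elim v L cs

⊃-intro : (a b : Bool) → (T a → T b) → T (not a ∨ b)
⊃-intro false b _ = tt
⊃-intro true  b f = f tt

⊃-elim : (a b : Bool) → T (not a ∨ b) → T a → T b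
⊃-elim true b t _ = t

shift : Term → Valuation → Valuation
shift s v P ts = v P (substαˡ s ts)

eval-substα : (v : Valuation) (s : Term) (A : Formula) →
  eval v (A [α↦ s ]) ≡ eval (shift s v) A
eval-substα v s (atom P ts) = refl
eval-substα v s ⊥f          = refl
eval-substα v s ⊤f          = refl
eval-substα v s (¬f A)   rewrite eval-substα v s A = refl
eval-substα v s (A ∧f B) rewrite eval-substα v s A | eval-substα v s B = refl
eval-substα v s (A ∨f B) rewrite eval-substα v s A | eval-substα v s B = refl
eval-substα v s (A ⊃f B) rewrite eval-substα v s A | eval-substα v s B = refl

⊨-substα : {A B : Formula} → A ⊨ B → (s : Term) → (A [α↦ s ]) ⊨ (B [α↦ s ])
⊨-substα {A} {B} A⊨B s v a =
  subst T (sym (eval-substα v s B)) (A⊨B (shift s v) (subst T (eval-substα v s A) a))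

⊨-instances : {A B : Formula} → A ⊨ B → (V : List Term) (v : Valuation) →
  v ⊩ instances A V → v ⊩ instances B V
⊨-instances {A} {B} A⊨B V v sat =
  map⁺ (All.map (λ {s} → ⊨-substα {A} {B} A⊨B s v) (map⁻ sat))

module _ (F : Formula) (x : ℕ) (U V : List Term) where

  solution-refutes : {C : Formula} → IsSolution F x U V C →
    (v : Valuation) → v ⊩ Γ F x U → (T (eval v C) → v ⊩ instances C V) → ⊥
  solution-refutes {C} sol v γ imp =
    refuted-by-valid sol v
      (++⁺ γ (⊃-intro (eval v C) _ (λ c → ⋀-intro v _ (imp c)) ∷ []))

  -- A solution is true in every model of Γ: where it is false, the
  -- implication  C ⊃ ⋀ⱼ C{α↦sⱼ}  holds vacuously.
  solution-holds-on-Γ : {C : Formula} → IsSolution F x U V C →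
    (v : Valuation) → v ⊩ Γ F x U → T (eval v C)
  solution-holds-on-Γ {C} sol v γ with T? (eval v C)
  ... | yes c = c
  ... | no ¬c with () ← solution-refutes sol v γ (λ c → ⊥-elim (¬c c))

  solution-instances-refuted : {C : Formula} → IsSolution F x U V C →
    Valid (instances C V ++ Γ F x U) []
  solution-instances-refuted {C} sol = valid-by-refutation λ v sat →
    let (inst , γ) = ++⁻ (instances C V) sat in solution-refutes sol v γ (λ _ → inst)

  solution-from-refuted-instances : {C : Formula} →
    ((v : Valuation) → v ⊩ Γ F x U → T (eval v C)) →
    Valid (instances C V ++ Γ F x U) [] → IsSolution F x U V C
  solution-from-refuted-instances {C} holds refuted = valid-by-refutation λ v sat →
    let (γ , imp) = ++⁻ (Γ F x U) sat
        inst = ⋀-elim v _ (⊃-elim (eval v C) _ (All.head imp) (holds v γ))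
    in refuted-by-valid refuted v (++⁺ inst γ)

lemma7 : (F : Formula) (x : ℕ) (U V : List Term) (A B : Formula) →
    A ⊨ B →
      ((¬ Valid (instances A V ++ Γ F x U) [] → ¬ IsSolution F x U V B)
      × (IsSolution F x U V A → Valid (Γ F x U) (B ∷ []))
      × (IsSolution F x U V A →
           (Valid (instances B V ++ Γ F x U) [] ⇔ IsSolution F x U V B)))
lemma7 F x U V A B A⊨B = part1 , part2 , part3
  where
  part1 : ¬ Valid (instances A V ++ Γ F x U) [] → ¬ IsSolution F x U V B
  part1 notValid solB = notValid (valid-by-refutation λ v sat →
    let (instA , γ) = ++⁻ (instances A V) sat
    in refuted-by-valid (solution-instances-refuted F x U V solB) v
         (++⁺ (⊨-instances A⊨B V v instA) γ))

  B-holds-on-Γ : IsSolution F x U V A → (v : Valuation) → v ⊩ Γ F x U → T (eval v B)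
  B-holds-on-Γ solA v γ = A⊨B v (solution-holds-on-Γ F x U V solA v γ)

  part2 : IsSolution F x U V A → Valid (Γ F x U) (B ∷ [])
  part2 solA v γ = here (B-holds-on-Γ solA v γ)

  part3 : IsSolution F x U V A →
    (Valid (instances B V ++ Γ F x U) [] ⇔ IsSolution F x U V B)
  part3 solA = mk⇔
    (solution-from-refuted-instances F x U V (B-holds-on-Γ solA))
    (solution-instances-refuted F x U V)
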